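{- Let $\mathcal{C}$ be a differential category with differential operator $\bar\partial_X:!X\otimes X\to\,!X$, and define $$\partial_X:=\bar\partial_X\circ(\mathrm{id}_{!X}\otimes\mathrm{der}_X)\circ(m^2_{X,X})^{ -1}:\ !(X\&X)\to\,!X .$$ Then $\mathrm{der}_X\circ\partial_X=\mathrm{der}_X\circ\,!\pi_1$, where $\pi_1:X\&X\to X$ is the second projection. Consequently, for the summability structure $S_\&X=X\&X$ (projections $\pi_0,\pi_1$, sum $\sigma=\pi_0+\pi_1$) and $D_X:=\langle !\pi_0,\partial_X\rangle:!(X\&X)\to\,!X\&!X$, one has $(\mathrm{der}_X\&\mathrm{der}_X)\circ D_X=\mathrm{der}_{X\&X}$.
   Context: A Seely category is a symmetric monoidal closed category $(\mathcal{C},\otimes,1)$ (left unitor $\lambda_A:1\otimes A\to A$) with finite products $(\&,\top)$, a comonad $(!,\mathrm{der},\mathrm{dig})$, and isomorphisms $m^0:1\to\,!\top$, $m^2_{A,B}:!A\otimes!B\to\,!(A\&B)$ (natural) making $!$ strong symmetric monoidal from $(\mathcal{C},\&,\top)$ to $(\mathcal{C},\otimes,1)$; weakening is $\mathrm{weak}_A:=(m^0)^{ -1}\circ\,!(t_A):!A\to1$ with $t_A:A\to\top$ terminal. An additive category is a Seely category whose hom-sets are commutative monoids with composition bilinear and $\otimes$ bilinear. A differential category is an additive category with a natural transformation $\bar\partial_X:!X\otimes X\to\,!X$ satisfying the differential-category axioms (interactions with $\mathrm{der},\mathrm{dig},\mathrm{weak},\mathrm{contr}$ and $\bar\partial$ itself);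 among them the linearity axiom $\mathrm{der}_X\circ\bar\partial_X=\lambda_X\circ(\mathrm{weak}_X\otimes\mathrm{id}_X)$. $\langle f,g\rangle$ denotes pairing into a product and $f\&g=\langle f\circ\pi_0,g\circ\pi_1\rangle$. -}

module Defs where

open import Level using (Level; _⊔_) renaming (suc to lsuc)
open import Relation.Binary.Core using (Rel)
open import Relation.Binary.Structures using (IsEquivalence)

record Category (o ℓ e : Level) : Set (lsuc (o ⊔ ℓ ⊔ e)) where
  infix  4 _≈_
  infixr 9 _∘_
  field
    Obj  : Set o
    _⇒_  : Obj → Obj → Set ℓ
    _≈_  : ∀ {A B} → Rel (A ⇒ B) e
    id   : ∀ {A} → A ⇒ A
    _∘_  : ∀ {A B C} → B ⇒ C → A ⇒ B → A ⇒ C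
    ≈-equiv    : ∀ {A B} → IsEquivalence (_≈_ {A} {B})
    ∘-resp-≈   : ∀ {A B C} {f f′ : B ⇒ C} {g g′ : A ⇒ B} →
                 f ≈ f′ → g ≈ g′ → f ∘ g ≈ f′ ∘ g′
    assoc      : ∀ {A B C D} {f : A ⇒ B} {g : B ⇒ C} {h : C ⇒ D} →
                 (h ∘ g) ∘ f ≈ h ∘ (g ∘ f)
    identityˡ  : ∀ {A B} {f : A ⇒ B} → id ∘ f ≈ f
    identityʳ  : ∀ {A B} {f : A ⇒ B} → f ∘ id ≈ f

record SeelyStructure {o ℓ e} (C : Category o ℓ e) : Set (o ⊔ ℓ ⊔ e) where
  open Category C
  infixr 10 _⊗₀_ _⊗₁_
  infixr 11 _&_
  field
    _⊗₀_ : Obj → Obj → Obj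
    _⊗₁_ : ∀ {A B C D} → A ⇒ B → C ⇒ D → (A ⊗₀ C) ⇒ (B ⊗₀ D)
    𝟙    : Obj
    ⊗-resp-≈ : ∀ {A B C D} {f f′ : A ⇒ B} {g g′ : C ⇒ D} →
               f ≈ f′ → g ≈ g′ → f ⊗₁ g ≈ f′ ⊗₁ g′
    ⊗-identity : ∀ {A B} → id {A} ⊗₁ id {B} ≈ id
    ⊗-homomorphism : ∀ {A B C D E F} {f : A ⇒ B} {g : B ⇒ C}
                       {h : D ⇒ E} {k : E ⇒ F} →
                     (g ∘ f) ⊗₁ (k ∘ h) ≈ (g ⊗₁ k) ∘ (f ⊗₁ h)
    λ⇒ : ∀ {A} → (𝟙 ⊗₀ A) ⇒ A
    λ⇐ : ∀ {A} → A ⇒ (𝟙 ⊗₀ A)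
    ρ⇒ : ∀ {A} → (A ⊗₀ 𝟙) ⇒ A
    ρ⇐ : ∀ {A} → A ⇒ (A ⊗₀ 𝟙)
    α⇒ : ∀ {A B C} → ((A ⊗₀ B) ⊗₀ C) ⇒ (A ⊗₀ (B ⊗₀ C))
    α⇐ : ∀ {A B C} → (A ⊗₀ (B ⊗₀ C)) ⇒ ((A ⊗₀ B) ⊗₀ C)
    σ⊗ : ∀ {A B} → (A ⊗₀ B) ⇒ (B ⊗₀ A)
    λ-isoˡ : ∀ {A} → λ⇐ {A} ∘ λ⇒ ≈ id
    λ-isoʳ : ∀ {A} → λ⇒ {A} ∘ λ⇐ ≈ id
    ρ-isoˡ : ∀ {A} → ρ⇐ {A} ∘ ρ⇒ ≈ id
    ρ-isoʳ : ∀ {A} → ρ⇒ {A} ∘ ρ⇐ ≈ id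
    α-isoˡ : ∀ {A B C} → α⇐ {A} {B} {C} ∘ α⇒ ≈ id
    α-isoʳ : ∀ {A B C} → α⇒ {A} {B} {C} ∘ α⇐ ≈ id
    λ-natural : ∀ {A B} {f : A ⇒ B} → f ∘ λ⇒ ≈ λ⇒ ∘ (id ⊗₁ f)
    ρ-natural : ∀ {A B} {f : A ⇒ B} → f ∘ ρ⇒ ≈ ρ⇒ ∘ (f ⊗₁ id)
    α-natural : ∀ {A B C D E F} {f : A ⇒ B} {g : C ⇒ D} {h : E ⇒ F} →
                α⇒ ∘ ((f ⊗₁ g) ⊗₁ h) ≈ (f ⊗₁ (g ⊗₁ h)) ∘ α⇒
    σ-natural : ∀ {A B C D} {f : A ⇒ B} {g : C ⇒ D} →
                σ⊗ ∘ (f ⊗₁ g) ≈ (g ⊗₁ f) ∘ σ⊗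
    σ-involutive : ∀ {A B} → σ⊗ {B} {A} ∘ σ⊗ {A} {B} ≈ id
    pentagon : ∀ {A B C D} →
               α⇒ {A} {B} {C ⊗₀ D} ∘ α⇒ {A ⊗₀ B} {C} {D}
               ≈ (id ⊗₁ α⇒) ∘ (α⇒ ∘ (α⇒ ⊗₁ id))
    triangle : ∀ {A B} → (id {A} ⊗₁ λ⇒ {B}) ∘ α⇒ ≈ ρ⇒ ⊗₁ id
    hexagon : ∀ {A B C} →
              α⇒ {B} {C} {A} ∘ (σ⊗ ∘ α⇒ {A} {B} {C})
              ≈ (id ⊗₁ σ⊗) ∘ (α⇒ ∘ (σ⊗ ⊗₁ id))
    _⊸_   : Obj → Obj → Obj
    ev    : ∀ {A B} → ((A ⊸ B) ⊗₀ A) ⇒ B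
    curry : ∀ {A B C} → (C ⊗₀ A) ⇒ B → C ⇒ (A ⊸ B)
    curry-resp-≈ : ∀ {A B C} {f g : (C ⊗₀ A) ⇒ B} → f ≈ g → curry f ≈ curry g
    curry-β : ∀ {A B C} {f : (C ⊗₀ A) ⇒ B} → ev ∘ (curry f ⊗₁ id) ≈ f
    curry-η : ∀ {A B C} {g : C ⇒ (A ⊸ B)} → curry (ev ∘ (g ⊗₁ id)) ≈ g
    _&_   : Obj → Obj → Obj
    ⊤     : Obj
    π₀    : ∀ {A B} → (A & B) ⇒ A
    π₁    : ∀ {A B} → (A & B) ⇒ B
    ⟨_,_⟩ : ∀ {A B C} → C ⇒ A → C ⇒ B → C ⇒ (A & B)
    π₀-⟨⟩ : ∀ {A B C} {f : C ⇒ A} {g : C ⇒ B} → π₀ ∘ ⟨ f , g ⟩ ≈ f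
    π₁-⟨⟩ : ∀ {A B C} {f : C ⇒ A} {g : C ⇒ B} → π₁ ∘ ⟨ f , g ⟩ ≈ g
    ⟨⟩-unique : ∀ {A B C} {f : C ⇒ A} {g : C ⇒ B} {h : C ⇒ (A & B)} →
                π₀ ∘ h ≈ f → π₁ ∘ h ≈ g → ⟨ f , g ⟩ ≈ h
    t        : ∀ {A} → A ⇒ ⊤
    t-unique : ∀ {A} {f : A ⇒ ⊤} → t ≈ f
    !₀ : Obj → Obj
    !₁ : ∀ {A B} → A ⇒ B → !₀ A ⇒ !₀ B
    !-resp-≈ : ∀ {A B} {f g : A ⇒ B} → f ≈ g → !₁ f ≈ !₁ g
    !-identity : ∀ {A} → !₁ (id {A}) ≈ id
    !-homomorphism : ∀ {A B C} {f : A ⇒ B} {g : B ⇒ C} →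
                     !₁ (g ∘ f) ≈ !₁ g ∘ !₁ f
    der : ∀ {A} → !₀ A ⇒ A
    dig : ∀ {A} → !₀ A ⇒ !₀ (!₀ A)
    der-natural : ∀ {A B} {f : A ⇒ B} → f ∘ der ≈ der ∘ !₁ f
    dig-natural : ∀ {A B} {f : A ⇒ B} → !₁ (!₁ f) ∘ dig ≈ dig ∘ !₁ f
    comonad-identityˡ : ∀ {A} → der { !₀ A} ∘ dig ≈ id
    comonad-identityʳ : ∀ {A} → !₁ (der {A}) ∘ dig ≈ id
    comonad-assoc     : ∀ {A} → dig { !₀ A} ∘ dig ≈ !₁ (dig {A}) ∘ dig
    m⁰  : 𝟙 ⇒ !₀ ⊤
    m⁰⁻¹ : !₀ ⊤ ⇒ 𝟙
    m²  : ∀ {A B} → (!₀ A ⊗₀ !₀ B) ⇒ !₀ (A & B)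
    m²⁻¹ : ∀ {A B} → !₀ (A & B) ⇒ (!₀ A ⊗₀ !₀ B)
    m⁰-isoˡ : m⁰⁻¹ ∘ m⁰ ≈ id
    m⁰-isoʳ : m⁰ ∘ m⁰⁻¹ ≈ id
    m²-isoˡ : ∀ {A B} → m²⁻¹ {A} {B} ∘ m² ≈ id
    m²-isoʳ : ∀ {A B} → m² {A} {B} ∘ m²⁻¹ ≈ id
    m²-natural : ∀ {A B C D} {f : A ⇒ B} {g : C ⇒ D} →
                 m² ∘ (!₁ f ⊗₁ !₁ g) ≈ !₁ ⟨ f ∘ π₀ , g ∘ π₁ ⟩ ∘ m²
    m-assoc : ∀ {A B C} →
              !₁ ⟨ π₀ ∘ π₀ , ⟨ π₁ ∘ π₀ , π₁ ⟩ ⟩ ∘ (m² {A & B} {C} ∘ (m² {A} {B} ⊗₁ id))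
              ≈ m² {A} {B & C} ∘ ((id ⊗₁ m² {B} {C}) ∘ α⇒)
    m-unitˡ : ∀ {A} → !₁ (π₁ {⊤} {A}) ∘ (m² ∘ (m⁰ ⊗₁ id)) ≈ λ⇒
    m-unitʳ : ∀ {A} → !₁ (π₀ {A} {⊤}) ∘ (m² ∘ (id ⊗₁ m⁰)) ≈ ρ⇒
    m-symmetry : ∀ {A B} → !₁ ⟨ π₁ , π₀ ⟩ ∘ m² {A} {B} ≈ m² {B} {A} ∘ σ⊗

  _&₁_ : ∀ {A B C D} → A ⇒ B → C ⇒ D → (A & C) ⇒ (B & D)
  f &₁ g = ⟨ f ∘ π₀ , g ∘ π₁ ⟩

  weak : ∀ {A} → !₀ A ⇒ 𝟙
  weak = m⁰⁻¹ ∘ !₁ t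

  contr : ∀ {A} → !₀ A ⇒ (!₀ A ⊗₀ !₀ A)
  contr = m²⁻¹ ∘ !₁ ⟨ id , id ⟩

record AdditiveStructure {o ℓ e} (C : Category o ℓ e) (S : SeelyStructure C)
       : Set (o ⊔ ℓ ⊔ e) where
  open Category C
  open SeelyStructure S
  infixl 6 _+_
  field
    _+_ : ∀ {A B} → A ⇒ B → A ⇒ B → A ⇒ B
    0⇒  : ∀ {A B} → A ⇒ B
    +-resp-≈ : ∀ {A B} {f f′ g g′ : A ⇒ B} → f ≈ f′ → g ≈ g′ → f + g ≈ f′ + g′
    +-assoc  : ∀ {A B} {f g h : A ⇒ B} → (f + g) + h ≈ f + (g + h)
    +-comm   : ∀ {A B} {f g : A ⇒ B} → f + g ≈ g + f
    +-identityˡ : ∀ {A B} {f : A ⇒ B} → 0⇒ + f ≈ f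
    ∘-distribˡ-+ : ∀ {A B C} {f : B ⇒ C} {g h : A ⇒ B} →
                   f ∘ (g + h) ≈ f ∘ g + f ∘ h
    ∘-distribʳ-+ : ∀ {A B C} {f : A ⇒ B} {g h : B ⇒ C} →
                   (g + h) ∘ f ≈ g ∘ f + h ∘ f
    ∘-zeroˡ : ∀ {A B C} {f : A ⇒ B} → 0⇒ {B} {C} ∘ f ≈ 0⇒
    ∘-zeroʳ : ∀ {A B C} {f : B ⇒ C} → f ∘ 0⇒ {A} {B} ≈ 0⇒
    ⊗-distribˡ-+ : ∀ {A B C D} {f : A ⇒ B} {g h : C ⇒ D} →
                   f ⊗₁ (g + h) ≈ f ⊗₁ g + f ⊗₁ h
    ⊗-distribʳ-+ : ∀ {A B C D} {f : A ⇒ B} {g h : C ⇒ D} →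
                   (g + h) ⊗₁ f ≈ g ⊗₁ f + h ⊗₁ f
    ⊗-zeroˡ : ∀ {A B C D} {f : C ⇒ D} → 0⇒ {A} {B} ⊗₁ f ≈ 0⇒
    ⊗-zeroʳ : ∀ {A B C D} {f : A ⇒ B} → f ⊗₁ 0⇒ {C} {D} ≈ 0⇒

record DifferentialStructure {o ℓ e} (C : Category o ℓ e) (S : SeelyStructure C)
       (Ad : AdditiveStructure C S) : Set (o ⊔ ℓ ⊔ e) where
  open Category C
  open SeelyStructure S
  open AdditiveStructure Ad
  field
    ∂̄ : ∀ {X} → (!₀ X ⊗₀ X) ⇒ !₀ X
    ∂̄-natural : ∀ {A B} {f : A ⇒ B} → ∂̄ ∘ (!₁ f ⊗₁ f) ≈ !₁ f ∘ ∂̄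
    ∂̄-weak : ∀ {X} → weak ∘ ∂̄ {X} ≈ 0⇒
    ∂̄-contr : ∀ {X} →
              contr ∘ ∂̄ {X}
              ≈ (∂̄ ⊗₁ id) ∘ (α⇐ ∘ ((id ⊗₁ σ⊗) ∘ (α⇒ ∘ (contr ⊗₁ id))))
                + (id ⊗₁ ∂̄) ∘ (α⇒ ∘ (contr ⊗₁ id))
    ∂̄-der : ∀ {X} → der ∘ ∂̄ {X} ≈ λ⇒ ∘ (weak ⊗₁ id)
    ∂̄-dig : ∀ {X} → dig ∘ ∂̄ {X} ≈ ∂̄ ∘ ((dig ⊗₁ ∂̄) ∘ (α⇒ ∘ (contr ⊗₁ id)))
    ∂̄-interchange : ∀ {X} →
                    ∂̄ ∘ ((∂̄ ⊗₁ id) ∘ (α⇐ ∘ ((id ⊗₁ σ⊗) ∘ α⇒)))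
                    ≈ ∂̄ {X} ∘ (∂̄ ⊗₁ id)

record DifferentialCategory (o ℓ e : Level) : Set (lsuc (o ⊔ ℓ ⊔ e)) where
  field
    category     : Category o ℓ e
    seely        : SeelyStructure category
    additive     : AdditiveStructure category seely
    differential : DifferentialStructure category seely additive
  open Category category public
  open SeelyStructure seely public
  open AdditiveStructure additive public
  open DifferentialStructure differential public

  ∂ : ∀ X → !₀ (X & X) ⇒ !₀ X
  ∂ X = ∂̄ ∘ ((id ⊗₁ der) ∘ m²⁻¹)

  D : ∀ X → !₀ (X & X) ⇒ (!₀ X & !₀ X)
  D X = ⟨ !₁ π₀ , ∂ X ⟩

{-# OPTIONS --safe #-}
module Submission where

-- The linear rule says that dereliction sees only the linear argument of ∂̄:
-- der ∘ ∂̄ ∘ (id ⊗ g) = g ∘ λ ∘ (weak ⊗ id).  For ∂ X that argument is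
-- der ∘ (the second Seely factor), and by the unit law of the Seely
-- isomorphisms λ ∘ (weak ⊗ id) ∘ (m²)⁻¹ = !π₁, so der ∘ ∂ X = der ∘ !π₁.
-- The second claim then holds componentwise: π₀ ∘ der = der ∘ !π₀ is
-- naturality of der, and π₁ ∘ der = der ∘ !π₁ = der ∘ ∂ X is the first claim.

open import Defs
open import Data.Product using (_×_; _,_)
open import Relation.Binary.Bundles using (Setoid)
import Relation.Binary.Reasoning.Setoid as SetoidReasoning

module CategoryReasoning {o ℓ e} (C : Category o ℓ e) where
  open Category C

  hom-setoid : Obj → Obj → Setoid ℓ e
  hom-setoid A B = record { Carrier = A ⇒ B ; _≈_ = _≈_ ; isEquivalence = ≈-equiv }

  module HomReasoning {A B : Obj} where
    open SetoidReasoning (hom-setoid A B) public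
    open Setoid (hom-setoid A B) public using (refl; sym; trans)

  open HomReasoning

  infixr 4 _⟩∘⟨_ refl⟩∘⟨_
  infixl 5 _⟩∘⟨refl

  _⟩∘⟨_ : ∀ {A B C} {f f′ : B ⇒ C} {g g′ : A ⇒ B} →
          f ≈ f′ → g ≈ g′ → f ∘ g ≈ f′ ∘ g′
  _⟩∘⟨_ = ∘-resp-≈

  refl⟩∘⟨_ : ∀ {A B C} {f : B ⇒ C} {g g′ : A ⇒ B} → g ≈ g′ → f ∘ g ≈ f ∘ g′
  refl⟩∘⟨ p = refl ⟩∘⟨ p

  _⟩∘⟨refl : ∀ {A B C} {f f′ : B ⇒ C} {g : A ⇒ B} → f ≈ f′ → f ∘ g ≈ f′ ∘ g
  p ⟩∘⟨refl = p ⟩∘⟨ refl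

  pullˡ : ∀ {A B C D} {a : C ⇒ D} {b : B ⇒ C} {c : B ⇒ D} {f : A ⇒ B} →
          a ∘ b ≈ c → a ∘ (b ∘ f) ≈ c ∘ f
  pullˡ p = trans (sym assoc) (p ⟩∘⟨refl)

  pullʳ : ∀ {A B C D} {a : C ⇒ D} {b : B ⇒ C} {c : A ⇒ B} {d : A ⇒ C} →
          b ∘ c ≈ d → (a ∘ b) ∘ c ≈ a ∘ d
  pullʳ p = trans assoc (refl⟩∘⟨ p)

  cancelʳ : ∀ {A B C} {a : B ⇒ A} {b : A ⇒ B} {f : A ⇒ C} →
            a ∘ b ≈ id → (f ∘ a) ∘ b ≈ f
  cancelʳ p = trans (pullʳ p) identityʳ

module SeelyLemmas {o ℓ e} {C : Category o ℓ e} (S : SeelyStructure C) where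
  open Category C
  open SeelyStructure S
  open CategoryReasoning C
  open HomReasoning

  ⊗-interchange : ∀ {A B C D} {f : A ⇒ B} {g : C ⇒ D} →
                  (f ⊗₁ id) ∘ (id ⊗₁ g) ≈ (id ⊗₁ g) ∘ (f ⊗₁ id)
  ⊗-interchange {f = f} {g} = begin
    (f ⊗₁ id) ∘ (id ⊗₁ g) ≈⟨ sym ⊗-homomorphism ⟩
    (f ∘ id) ⊗₁ (id ∘ g)  ≈⟨ ⊗-resp-≈ (trans identityʳ (sym identityˡ))
                                      (trans identityˡ (sym identityʳ)) ⟩
    (id ∘ f) ⊗₁ (g ∘ id)  ≈⟨ ⊗-homomorphism ⟩
    (id ⊗₁ g) ∘ (f ⊗₁ id) ∎

  &₁-∘-⟨⟩ : ∀ {A B C D E} {f : A ⇒ B} {g : C ⇒ D} {h : E ⇒ A} {k : E ⇒ C} →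
            (f &₁ g) ∘ ⟨ h , k ⟩ ≈ ⟨ f ∘ h , g ∘ k ⟩
  &₁-∘-⟨⟩ = sym (⟨⟩-unique (trans (pullˡ π₀-⟨⟩) (pullʳ π₀-⟨⟩))
                           (trans (pullˡ π₁-⟨⟩) (pullʳ π₁-⟨⟩)))

  !t≈m⁰∘weak : ∀ {A} → !₁ (t {A}) ≈ m⁰ ∘ weak
  !t≈m⁰∘weak = sym (trans (pullˡ m⁰-isoʳ) identityˡ)

  !π₁∘m²≈λ∘weak⊗id : ∀ {A B} → !₁ (π₁ {A} {B}) ∘ m² ≈ λ⇒ ∘ (weak ⊗₁ id)
  !π₁∘m²≈λ∘weak⊗id = begin
    !₁ π₁ ∘ m²                                  ≈⟨ !-resp-≈ (sym (trans π₁-⟨⟩ identityˡ)) ⟩∘⟨refl ⟩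
    !₁ (π₁ ∘ (t &₁ id)) ∘ m²                    ≈⟨ !-homomorphism ⟩∘⟨refl ⟩
    (!₁ π₁ ∘ !₁ (t &₁ id)) ∘ m²                 ≈⟨ pullʳ (sym m²-natural) ⟩
    !₁ π₁ ∘ (m² ∘ (!₁ t ⊗₁ !₁ id))              ≈⟨ refl⟩∘⟨ refl⟩∘⟨ ⊗-resp-≈ !t≈m⁰∘weak
                                                      (trans !-identity (sym identityˡ)) ⟩
    !₁ π₁ ∘ (m² ∘ ((m⁰ ∘ weak) ⊗₁ (id ∘ id)))   ≈⟨ refl⟩∘⟨ refl⟩∘⟨ ⊗-homomorphism ⟩
    !₁ π₁ ∘ (m² ∘ ((m⁰ ⊗₁ id) ∘ (weak ⊗₁ id)))  ≈⟨ refl⟩∘⟨ sym assoc ⟩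
    !₁ π₁ ∘ ((m² ∘ (m⁰ ⊗₁ id)) ∘ (weak ⊗₁ id))  ≈⟨ pullˡ m-unitˡ ⟩
    λ⇒ ∘ (weak ⊗₁ id)                           ∎

module _ {o ℓ e} (𝒞 : DifferentialCategory o ℓ e) where
  open DifferentialCategory 𝒞
  open CategoryReasoning category
  open HomReasoning
  open SeelyLemmas seely

  der∘∂̄∘id⊗g≈g∘λ∘weak⊗id : ∀ {A X} {g : A ⇒ X} →
                          der ∘ (∂̄ ∘ (id ⊗₁ g)) ≈ g ∘ (λ⇒ ∘ (weak ⊗₁ id))
  der∘∂̄∘id⊗g≈g∘λ∘weak⊗id {g = g} = begin
    der ∘ (∂̄ ∘ (id ⊗₁ g))             ≈⟨ pullˡ ∂̄-der ⟩
    (λ⇒ ∘ (weak ⊗₁ id)) ∘ (id ⊗₁ g)   ≈⟨ pullʳ ⊗-interchange ⟩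
    λ⇒ ∘ ((id ⊗₁ g) ∘ (weak ⊗₁ id))   ≈⟨ pullˡ (sym λ-natural) ⟩
    (g ∘ λ⇒) ∘ (weak ⊗₁ id)           ≈⟨ assoc ⟩
    g ∘ (λ⇒ ∘ (weak ⊗₁ id))           ∎

  der∘∂≈der∘!π₁ : ∀ {X} → der ∘ ∂ X ≈ der ∘ !₁ (π₁ {X} {X})
  der∘∂≈der∘!π₁ = begin
    der ∘ (∂̄ ∘ ((id ⊗₁ der) ∘ m²⁻¹))   ≈⟨ trans (refl⟩∘⟨ sym assoc) (sym assoc) ⟩
    (der ∘ (∂̄ ∘ (id ⊗₁ der))) ∘ m²⁻¹   ≈⟨ der∘∂̄∘id⊗g≈g∘λ∘weak⊗id ⟩∘⟨refl ⟩
    (der ∘ (λ⇒ ∘ (weak ⊗₁ id))) ∘ m²⁻¹ ≈⟨ (refl⟩∘⟨ sym !π₁∘m²≈λ∘weak⊗id) ⟩∘⟨refl ⟩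
    (der ∘ (!₁ π₁ ∘ m²)) ∘ m²⁻¹        ≈⟨ pullʳ (cancelʳ m²-isoʳ) ⟩
    der ∘ !₁ π₁                        ∎

  der&der∘D≈der : ∀ {X} → (der &₁ der) ∘ D X ≈ der {X & X}
  der&der∘D≈der = trans &₁-∘-⟨⟩
    (⟨⟩-unique der-natural (trans der-natural (sym der∘∂≈der∘!π₁)))

mainTheorem5 : ∀ {o ℓ e} (𝒞 : DifferentialCategory o ℓ e) →
    let open DifferentialCategory 𝒞 in
    ∀ {X : Obj} →
      (der ∘ ∂ X ≈ der ∘ !₁ (π₁ {X} {X}))
      × ((der &₁ der) ∘ D X ≈ der {X & X})
mainTheorem5 𝒞 = der∘∂≈der∘!π₁ 𝒞 , der&der∘D≈der 𝒞
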